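{- Let $\mathcal{M}$ be an $8$-divisible multiset of points in $\mathrm{PG}(v-1,2)$ with cardinality $23$. Then $\gamma_1(\mathcal{M})\ge8$.
   Context: $\mathrm{PG}(v-1,2)$ is the projective geometry of $\mathbb{F}_2^v$; points and hyperplanes are subspaces of dimension $1$ and $v-1$. A multiset of points $\mathcal{M}$ assigns to each point $P$ a multiplicity $\mathcal{M}(P)\in\{0,1,2,\dots\}$; $\mathcal{M}(K)=\sum_{P\le K}\mathcal{M}(P)$ for a subspace $K$, and $\#\mathcal{M}=\mathcal{M}(\mathbb{F}_2^v)$. $\mathcal{M}$ is $\Delta$-divisible if $\mathcal{M}(H)\equiv\#\mathcal{M}\pmod\Delta$ for every hyperplane $H$. $\gamma_1(\mathcal{M})=\max_P\mathcal{M}(P)$. -}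

module Defs where

open import Data.Bool using (Bool; true; false; _∧_; _xor_; not; if_then_else_)
open import Data.Nat using (ℕ; zero; suc; _+_; _%_; _⊔_; NonZero)
open import Data.Nat.ListAction using (sum)
open import Data.List using (List; []; _∷_; map; _++_; filter; foldr)
open import Data.Vec using (Vec; []; _∷_)
open import Data.Product using (Σ; _×_; _,_)
open import Relation.Binary.PropositionalEquality using (_≡_)

-- F_2 is modelled by Bool (false = 0, true = 1, xor = addition, ∧ = multiplication).
-- Vectors of F_2^v are  Vec Bool v.

allVecs : (v : ℕ) → List (Vec Bool v)
allVecs zero = [] ∷ []
allVecs (suc v) = map (false ∷_) (allVecs v) ++ map (true ∷_) (allVecs v)

isZeroVec : ∀ {v} → Vec Bool v → Bool
isZeroVec [] = true
isZeroVec (b ∷ x) = not b ∧ isZeroVec x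

-- nonzero vectors; each represents exactly one point of PG(v-1,2)
-- (over F_2 a 1-dimensional subspace has a unique nonzero vector)
nonzeroVecs : (v : ℕ) → List (Vec Bool v)
nonzeroVecs v = filter (λ x → Data.Bool._≟_ (isZeroVec x) false) (allVecs v)

NonZeroVec : ∀ {v} → Vec Bool v → Set
NonZeroVec x = isZeroVec x ≡ false

dot : ∀ {v} → Vec Bool v → Vec Bool v → Bool
dot [] [] = false
dot (a ∷ as) (x ∷ xs) = (a ∧ x) xor dot as xs

-- A multiset of points of PG(v-1,2): a multiplicity for each point,
-- i.e. for each nonzero vector (the value at the zero vector is ignored).
Multiset : ℕ → Set
Multiset v = Vec Bool v → ℕ

card : ∀ {v} → Multiset v → ℕ
card {v} M = sum (map M (nonzeroVecs v))

-- Every hyperplane of F_2^v is  H_a = { x | a · x = 0 }  for a unique nonzero a.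
-- M(H_a) = sum of multiplicities of the points in H_a
hypMass : ∀ {v} → Multiset v → Vec Bool v → ℕ
hypMass {v} M a =
  sum (map M (filter (λ x → Data.Bool._≟_ (dot a x) false) (nonzeroVecs v)))

Divisible : ∀ {v} → (Δ : ℕ) → .{{NonZero Δ}} → Multiset v → Set
Divisible {v} Δ M =
  ∀ (a : Vec Bool v) → NonZeroVec a → (hypMass M a) % Δ ≡ (card M) % Δ

-- γ₁(M) = max_P M(P)
-- (γ₁ = maximum multiplicity over the finite list of points; 0 if there are no points)
γ₁ : ∀ {v} → Multiset v → ℕ
γ₁ {v} M = foldr (λ x m → M x ⊔ m) 0 (nonzeroVecs v)

-- Let w(a) = #M − M(H_a) be the mass off the hyperplane H_a = a⊥. Since M(H_a) ≡ 23 (mod 8),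
-- every w(a) lies in {0, 8, 16}. Summing over all a ∈ F₂^v gives Σ w = 2^(v−1)·23 and
-- Σ w² = 2^(v−2)·(23² + Σ M(P)²), and (w − 8)(w − 16) ≥ 0 then rules out a multiset with all
-- multiplicities ≤ 1. So if γ₁ ≤ 7, some point P has 2 ≤ M(P) ≤ 7. Summing w over the hyperplanes
-- through P gives 2^(v−2)·(23 − M(P)) > 8·(2^(v−1) − 1), so some H_a ∋ P has w(a) = 16, i.e.
-- M(H_a) = 7. For the restriction g of M to H_a, the g-mass u(b) off b⊥ satisfies
-- 2u(b) + 16 = w(b) + w(a + b), hence u(b) ∈ {0, 4}; since u(b) ≥ M(P) ≥ 2 when b·P = 1, summing
-- u over those b gives 2^(v−2)·(7 + M(P)) = 2^(v+1), i.e. M(P) = 1, a contradiction.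

module Submission where

open import Defs
open import Data.Bool using (Bool; true; false; _∧_; _xor_; not)
open import Data.Bool.Properties using (xor-∧-commutativeRing; ∧-distribˡ-xor; ∧-distribʳ-xor; xor-same; not-involutive)
open import Data.Nat
open import Data.Nat.Properties
open import Data.Nat.DivMod using (m≡m%n+[m/n]*n)
open import Data.Nat.Tactic.RingSolver using (solve-∀)
open import Data.Nat.ListAction using (sum)
open import Data.Nat.ListAction.Properties using (sum-++)
open import Data.List using (List; []; _∷_; map; _++_; filter; foldr)
open import Data.List.Membership.Propositional using (_∈_)
open import Data.List.Membership.Propositional.Properties using (∈-filter⁺; ∈-map⁺; ∈-++⁺ˡ; ∈-++⁺ʳ)
open import Data.List.Relation.Unary.Any using (here; there)
open import Data.List.Properties using (map-++; map-∘)
open import Data.Vec using (Vec; []; _∷_; zipWith; replicate)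
open import Data.Vec.Properties using (≡-dec)
open import Data.Empty using (⊥; ⊥-elim)
open import Relation.Nullary using (Dec; does; yes; no; ¬_)
open import Relation.Binary.PropositionalEquality
open import Algebra.Bundles using (CommutativeRing)
open import Algebra.Properties.CommutativeSemigroup +-commutativeSemigroup
  using () renaming (interchange to +-interchange)
open import Algebra.Properties.CommutativeSemigroup *-commutativeSemigroup
  using () renaming (x∙yz≈y∙xz to *-left-comm)
open import Algebra.Properties.CommutativeSemigroup
  (CommutativeRing.+-commutativeSemigroup xor-∧-commutativeRing)
  using () renaming (interchange to xor-interchange)

⟦_⟧ : Bool → ℕ
⟦ true ⟧ = 1
⟦ false ⟧ = 0

⟦not⟧+⟦⟧ : ∀ b n → ⟦ not b ⟧ * n + ⟦ b ⟧ * n ≡ n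
⟦not⟧+⟦⟧ true n = +-identityʳ n
⟦not⟧+⟦⟧ false n = trans (+-identityʳ (n + 0)) (+-identityʳ n)

⟦⟧*-≤ : ∀ b n → ⟦ b ⟧ * n ≤ n
⟦⟧*-≤ true n = ≤-reflexive (+-identityʳ n)
⟦⟧*-≤ false n = z≤n

2⟦⟧⟦not⟧+⟦⟧ : ∀ p q n → 2 * (⟦ q ⟧ * (⟦ not p ⟧ * n)) + ⟦ p ⟧ * n ≡ ⟦ q ⟧ * n + ⟦ p xor q ⟧ * n
2⟦⟧⟦not⟧+⟦⟧ true true = solve-∀
2⟦⟧⟦not⟧+⟦⟧ true false = solve-∀
2⟦⟧⟦not⟧+⟦⟧ false true = solve-∀
2⟦⟧⟦not⟧+⟦⟧ false false = solve-∀

module _ {A : Set} where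

  sum-map-cong : ∀ xs {f g : A → ℕ} → (∀ x → f x ≡ g x) → sum (map f xs) ≡ sum (map g xs)
  sum-map-cong [] e = refl
  sum-map-cong (x ∷ xs) e = cong₂ _+_ (e x) (sum-map-cong xs e)

  sum-map-mono : ∀ xs {f g : A → ℕ} → (∀ x → f x ≤ g x) → sum (map f xs) ≤ sum (map g xs)
  sum-map-mono [] e = z≤n
  sum-map-mono (x ∷ xs) e = +-mono-≤ (e x) (sum-map-mono xs e)

  sum-map-+ : ∀ xs (f g : A → ℕ) → sum (map (λ x → f x + g x) xs) ≡ sum (map f xs) + sum (map g xs)
  sum-map-+ [] f g = refl
  sum-map-+ (x ∷ xs) f g = trans (cong (f x + g x +_) (sum-map-+ xs f g)) (+-interchange (f x) (g x) _ _)

  sum-map-*ˡ : ∀ xs c (f : A → ℕ) → sum (map (λ x → c * f x) xs) ≡ c * sum (map f xs)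
  sum-map-*ˡ [] c f = sym (*-zeroʳ c)
  sum-map-*ˡ (x ∷ xs) c f = trans (cong (c * f x +_) (sum-map-*ˡ xs c f)) (sym (*-distribˡ-+ c (f x) _))

  sum-map-filter : ∀ xs (p : A → Bool) (f : A → ℕ) →
    sum (map f (filter (λ x → Data.Bool._≟_ (p x) false) xs)) ≡ sum (map (λ x → ⟦ not (p x) ⟧ * f x) xs)
  sum-map-filter [] p f = refl
  sum-map-filter (x ∷ xs) p f with p x
  ... | true = sum-map-filter xs p f
  ... | false = cong₂ _+_ (sym (+-identityʳ (f x))) (sum-map-filter xs p f)

sum-map-swap : ∀ {A B : Set} xs ys (f : A → B → ℕ) →
  sum (map (λ x → sum (map (f x) ys)) xs) ≡ sum (map (λ y → sum (map (λ x → f x y) xs)) ys)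
sum-map-swap [] ys f = sym (sum-map-*ˡ ys 0 (λ _ → 0))
sum-map-swap (x ∷ xs) ys f = trans (cong (_ +_) (sum-map-swap xs ys f)) (sym (sum-map-+ ys (f x) _))

∑ : ∀ {v} → (Vec Bool v → ℕ) → ℕ
∑ {v} f = sum (map f (allVecs v))

∑-cong : ∀ {v} {f g : Vec Bool v → ℕ} → (∀ x → f x ≡ g x) → ∑ f ≡ ∑ g
∑-cong = sum-map-cong (allVecs _)

∑-mono : ∀ {v} {f g : Vec Bool v → ℕ} → (∀ x → f x ≤ g x) → ∑ f ≤ ∑ g
∑-mono = sum-map-mono (allVecs _)

∑-+ : ∀ {v} (f g : Vec Bool v → ℕ) → ∑ (λ x → f x + g x) ≡ ∑ f + ∑ g
∑-+ = sum-map-+ (allVecs _)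

∑-*ˡ : ∀ {v} c (f : Vec Bool v → ℕ) → ∑ (λ x → c * f x) ≡ c * ∑ f
∑-*ˡ = sum-map-*ˡ (allVecs _)

∑-*ʳ : ∀ {v} c (f : Vec Bool v → ℕ) → ∑ (λ x → f x * c) ≡ ∑ f * c
∑-*ʳ c f = trans (∑-cong (λ x → *-comm (f x) c)) (trans (∑-*ˡ c f) (*-comm c (∑ f)))

∑-swap : ∀ {v} (f : Vec Bool v → Vec Bool v → ℕ) → ∑ (λ x → ∑ (f x)) ≡ ∑ (λ y → ∑ (λ x → f x y))
∑-swap = sum-map-swap (allVecs _) (allVecs _)

∑-suc : ∀ {v} (f : Vec Bool (suc v) → ℕ) → ∑ f ≡ ∑ (λ x → f (false ∷ x)) + ∑ (λ x → f (true ∷ x))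
∑-suc {v} f = begin
  sum (map f (map (false ∷_) L ++ map (true ∷_) L))          ≡⟨ cong sum (map-++ f (map (false ∷_) L) _) ⟩
  sum (map f (map (false ∷_) L) ++ map f (map (true ∷_) L))  ≡⟨ sum-++ (map f (map (false ∷_) L)) _ ⟩
  sum (map f (map (false ∷_) L)) + sum (map f (map (true ∷_) L))
    ≡⟨ cong₂ _+_ (cong sum (sym (map-∘ L))) (cong sum (sym (map-∘ L))) ⟩
  ∑ (λ x → f (false ∷ x)) + ∑ (λ x → f (true ∷ x))            ∎
  where open ≡-Reasoning
        L = allVecs v

∑-const : ∀ v c → ∑ {v} (λ _ → c) ≡ c * 2 ^ v
∑-const zero c = trans (+-identityʳ c) (sym (*-identityʳ c))
∑-const (suc v) c = begin
  ∑ {suc v} (λ _ → c)               ≡⟨ ∑-suc {v} (λ _ → c) ⟩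
  ∑ {v} (λ _ → c) + ∑ {v} (λ _ → c) ≡⟨ cong₂ _+_ (∑-const v c) (∑-const v c) ⟩
  c * 2 ^ v + c * 2 ^ v             ≡⟨ *-distribˡ-+ c (2 ^ v) (2 ^ v) ⟨
  c * (2 ^ v + 2 ^ v)               ≡⟨ cong (λ n → c * (2 ^ v + n)) (+-identityʳ (2 ^ v)) ⟨
  c * 2 ^ suc v                     ∎
  where open ≡-Reasoning

_≟ᵛ_ : ∀ {v} (x y : Vec Bool v) → Dec (x ≡ y)
_≟ᵛ_ = ≡-dec Data.Bool._≟_

∑-δ : ∀ {v} (x : Vec Bool v) (f : Vec Bool v → ℕ) → ∑ (λ y → ⟦ does (x ≟ᵛ y) ⟧ * f y) ≡ f x
∑-δ [] f = trans (+-identityʳ _) (+-identityʳ (f []))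
∑-δ {suc v} (false ∷ x) f = begin
  ∑ (λ y → ⟦ does ((false ∷ x) ≟ᵛ y) ⟧ * f y)
    ≡⟨ ∑-suc (λ y → ⟦ does ((false ∷ x) ≟ᵛ y) ⟧ * f y) ⟩
  ∑ (λ y → ⟦ does (x ≟ᵛ y) ⟧ * f (false ∷ y)) + ∑ {v} (λ _ → 0)
    ≡⟨ cong₂ _+_ (∑-δ x (λ y → f (false ∷ y))) (∑-const v 0) ⟩
  f (false ∷ x) + 0
    ≡⟨ +-identityʳ _ ⟩
  f (false ∷ x) ∎
  where open ≡-Reasoning
∑-δ {suc v} (true ∷ x) f =
  trans (∑-suc (λ y → ⟦ does ((true ∷ x) ≟ᵛ y) ⟧ * f y))
        (cong₂ _+_ (∑-const v 0) (∑-δ x (λ y → f (true ∷ y))))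

term≤∑ : ∀ {v} (x : Vec Bool v) (f : Vec Bool v → ℕ) → f x ≤ ∑ f
term≤∑ x f = subst (_≤ ∑ f) (∑-δ x f) (∑-mono (λ y → ⟦⟧*-≤ (does (x ≟ᵛ y)) (f y)))

_⊕_ : ∀ {v} → Vec Bool v → Vec Bool v → Vec Bool v
_⊕_ = zipWith _xor_

dot-⊕ˡ : ∀ {v} (a b x : Vec Bool v) → dot (a ⊕ b) x ≡ dot a x xor dot b x
dot-⊕ˡ [] [] [] = refl
dot-⊕ˡ (a ∷ as) (b ∷ bs) (x ∷ xs) = begin
  ((a xor b) ∧ x) xor dot (as ⊕ bs) xs
    ≡⟨ cong₂ _xor_ (∧-distribʳ-xor x a b) (dot-⊕ˡ as bs xs) ⟩
  ((a ∧ x) xor (b ∧ x)) xor (dot as xs xor dot bs xs)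
    ≡⟨ xor-interchange (a ∧ x) (b ∧ x) _ _ ⟩
  ((a ∧ x) xor dot as xs) xor ((b ∧ x) xor dot bs xs) ∎
  where open ≡-Reasoning

dot-⊕ʳ : ∀ {v} (a x y : Vec Bool v) → dot a (x ⊕ y) ≡ dot a x xor dot a y
dot-⊕ʳ [] [] [] = refl
dot-⊕ʳ (a ∷ as) (x ∷ xs) (y ∷ ys) = begin
  (a ∧ (x xor y)) xor dot as (xs ⊕ ys)
    ≡⟨ cong₂ _xor_ (∧-distribˡ-xor a x y) (dot-⊕ʳ as xs ys) ⟩
  ((a ∧ x) xor (a ∧ y)) xor (dot as xs xor dot as ys)
    ≡⟨ xor-interchange (a ∧ x) (a ∧ y) _ _ ⟩
  ((a ∧ x) xor dot as xs) xor ((a ∧ y) xor dot as ys) ∎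
  where open ≡-Reasoning

replicate-isZero : ∀ v → isZeroVec (replicate v false) ≡ true
replicate-isZero zero = refl
replicate-isZero (suc v) = replicate-isZero v

dot-zeroˡ : ∀ {v} (a x : Vec Bool v) → isZeroVec a ≡ true → dot a x ≡ false
dot-zeroˡ [] [] _ = refl
dot-zeroˡ (false ∷ a) (x ∷ xs) z = dot-zeroˡ a xs z

⊕-zero⇒≡ : ∀ {v} (x y : Vec Bool v) → isZeroVec (x ⊕ y) ≡ true → x ≡ y
⊕-zero⇒≡ [] [] _ = refl
⊕-zero⇒≡ (false ∷ x) (false ∷ y) z = cong (false ∷_) (⊕-zero⇒≡ x y z)
⊕-zero⇒≡ (true ∷ x) (true ∷ y) z = cong (true ∷_) (⊕-zero⇒≡ x y z)

≢⇒⊕-nonZero : ∀ {v} (x y : Vec Bool v) → x ≢ y → NonZeroVec (x ⊕ y)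
≢⇒⊕-nonZero x y x≢y with isZeroVec (x ⊕ y) in z
... | true = ⊥-elim (x≢y (⊕-zero⇒≡ x y z))
... | false = refl

∑⟦⟧+∑⟦not⟧ : ∀ {v} (p : Vec Bool v → Bool) → ∑ (λ a → ⟦ p a ⟧) + ∑ (λ a → ⟦ not (p a) ⟧) ≡ 2 ^ v
∑⟦⟧+∑⟦not⟧ {v} p = begin
  ∑ (λ a → ⟦ p a ⟧) + ∑ (λ a → ⟦ not (p a) ⟧) ≡⟨ ∑-+ (λ a → ⟦ p a ⟧) (λ a → ⟦ not (p a) ⟧) ⟨
  ∑ (λ a → ⟦ p a ⟧ + ⟦ not (p a) ⟧)           ≡⟨ ∑-cong (λ a → ⟦⟧+⟦not⟧ (p a)) ⟩
  ∑ {v} (λ _ → 1)                             ≡⟨ ∑-const v 1 ⟩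
  1 * 2 ^ v                                   ≡⟨ *-identityˡ (2 ^ v) ⟩
  2 ^ v                                       ∎
  where open ≡-Reasoning
        ⟦⟧+⟦not⟧ : ∀ b → ⟦ b ⟧ + ⟦ not b ⟧ ≡ 1
        ⟦⟧+⟦not⟧ true = refl
        ⟦⟧+⟦not⟧ false = refl

∑-dot-balanced : ∀ {v} (x : Vec Bool v) → NonZeroVec x → ∑ (λ a → ⟦ dot a x ⟧) ≡ ∑ (λ a → ⟦ not (dot a x) ⟧)
∑-dot-balanced (true ∷ x) _ = begin
  ∑ (λ a → ⟦ dot a (true ∷ x) ⟧)                           ≡⟨ ∑-suc (λ a → ⟦ dot a (true ∷ x) ⟧) ⟩
  ∑ (λ a → ⟦ dot a x ⟧) + ∑ (λ a → ⟦ not (dot a x) ⟧)     ≡⟨ +-comm (∑ (λ a → ⟦ dot a x ⟧)) _ ⟩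
  ∑ (λ a → ⟦ not (dot a x) ⟧) + ∑ (λ a → ⟦ dot a x ⟧)
    ≡⟨ cong (∑ (λ a → ⟦ not (dot a x) ⟧) +_) (∑-cong (λ a → cong ⟦_⟧ (not-involutive (dot a x)))) ⟨
  ∑ (λ a → ⟦ not (dot a x) ⟧) + ∑ (λ a → ⟦ not (not (dot a x)) ⟧)
    ≡⟨ ∑-suc (λ a → ⟦ not (dot a (true ∷ x)) ⟧) ⟨
  ∑ (λ a → ⟦ not (dot a (true ∷ x)) ⟧)                     ∎
  where open ≡-Reasoning
∑-dot-balanced (false ∷ x) nz = begin
  ∑ (λ a → ⟦ dot a (false ∷ x) ⟧)                              ≡⟨ ∑-suc (λ a → ⟦ dot a (false ∷ x) ⟧) ⟩
  ∑ (λ a → ⟦ dot a x ⟧) + ∑ (λ a → ⟦ dot a x ⟧)               ≡⟨ cong₂ _+_ balanced balanced ⟩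
  ∑ (λ a → ⟦ not (dot a x) ⟧) + ∑ (λ a → ⟦ not (dot a x) ⟧)   ≡⟨ ∑-suc (λ a → ⟦ not (dot a (false ∷ x)) ⟧) ⟨
  ∑ (λ a → ⟦ not (dot a (false ∷ x)) ⟧)                        ∎
  where open ≡-Reasoning
        balanced = ∑-dot-balanced x nz

∑-dot : ∀ {v} (x : Vec Bool v) → NonZeroVec x → 2 * ∑ (λ a → ⟦ dot a x ⟧) ≡ 2 ^ v
∑-dot {v} x nz = begin
  2 * X      ≡⟨ cong (X +_) (+-identityʳ X) ⟩
  X + X      ≡⟨ cong (X +_) (∑-dot-balanced x nz) ⟩
  X + X̅      ≡⟨ ∑⟦⟧+∑⟦not⟧ (λ a → dot a x) ⟩
  2 ^ v      ∎
  where open ≡-Reasoning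
        X = ∑ (λ a → ⟦ dot a x ⟧)
        X̅ = ∑ (λ a → ⟦ not (dot a x) ⟧)

∑-not-dot : ∀ {v} (x : Vec Bool v) → NonZeroVec x → 2 * ∑ (λ a → ⟦ not (dot a x) ⟧) ≡ 2 ^ v
∑-not-dot {v} x nz = begin
  2 * X̅      ≡⟨ cong (X̅ +_) (+-identityʳ X̅) ⟩
  X̅ + X̅      ≡⟨ cong (_+ X̅) (∑-dot-balanced x nz) ⟨
  X + X̅      ≡⟨ ∑⟦⟧+∑⟦not⟧ (λ a → dot a x) ⟩
  2 ^ v      ∎
  where open ≡-Reasoning
        X = ∑ (λ a → ⟦ dot a x ⟧)
        X̅ = ∑ (λ a → ⟦ not (dot a x) ⟧)

∑-dot-dot+∑-dot-⊕ : ∀ {v} (x y : Vec Bool v) → NonZeroVec x → NonZeroVec y →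
  4 * ∑ (λ a → ⟦ dot a x ⟧ * ⟦ dot a y ⟧) + 2 * ∑ (λ a → ⟦ dot a (x ⊕ y) ⟧) ≡ 2 ^ v + 2 ^ v
∑-dot-dot+∑-dot-⊕ {v} x y nx ny = begin
  4 * C + 2 * D                                    ≡⟨ cong (_+ 2 * D) (*-assoc 2 2 C) ⟩
  2 * (2 * C) + 2 * D                              ≡⟨ *-distribˡ-+ 2 (2 * C) D ⟨
  2 * (2 * C + D)
    ≡⟨ cong (λ n → 2 * (n + D)) (∑-*ˡ 2 (λ a → ⟦ dot a x ⟧ * ⟦ dot a y ⟧)) ⟨
  2 * (∑ (λ a → 2 * (⟦ dot a x ⟧ * ⟦ dot a y ⟧)) + D)
    ≡⟨ cong (2 *_) (∑-+ (λ a → 2 * (⟦ dot a x ⟧ * ⟦ dot a y ⟧)) _) ⟨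
  2 * ∑ (λ a → 2 * (⟦ dot a x ⟧ * ⟦ dot a y ⟧) + ⟦ dot a (x ⊕ y) ⟧)
    ≡⟨ cong (2 *_) (∑-cong (λ a → trans (cong (λ b → 2 * (⟦ dot a x ⟧ * ⟦ dot a y ⟧) + ⟦ b ⟧) (dot-⊕ʳ a x y))
                                         (⟦⟧⟦⟧+⟦xor⟧ (dot a x) (dot a y)))) ⟩
  2 * ∑ (λ a → ⟦ dot a x ⟧ + ⟦ dot a y ⟧)          ≡⟨ cong (2 *_) (∑-+ (λ a → ⟦ dot a x ⟧) _) ⟩
  2 * (∑ (λ a → ⟦ dot a x ⟧) + ∑ (λ a → ⟦ dot a y ⟧)) ≡⟨ *-distribˡ-+ 2 (∑ (λ a → ⟦ dot a x ⟧)) _ ⟩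
  2 * ∑ (λ a → ⟦ dot a x ⟧) + 2 * ∑ (λ a → ⟦ dot a y ⟧) ≡⟨ cong₂ _+_ (∑-dot x nx) (∑-dot y ny) ⟩
  2 ^ v + 2 ^ v                                    ∎
  where open ≡-Reasoning
        C = ∑ (λ a → ⟦ dot a x ⟧ * ⟦ dot a y ⟧)
        D = ∑ (λ a → ⟦ dot a (x ⊕ y) ⟧)
        ⟦⟧⟦⟧+⟦xor⟧ : ∀ p q → 2 * (⟦ p ⟧ * ⟦ q ⟧) + ⟦ p xor q ⟧ ≡ ⟦ p ⟧ + ⟦ q ⟧
        ⟦⟧⟦⟧+⟦xor⟧ true true = refl
        ⟦⟧⟦⟧+⟦xor⟧ true false = refl
        ⟦⟧⟦⟧+⟦xor⟧ false true = refl
        ⟦⟧⟦⟧+⟦xor⟧ false false = refl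

∑-dot-dot : ∀ {v} (x y : Vec Bool v) → NonZeroVec x → NonZeroVec y →
  4 * ∑ (λ a → ⟦ dot a x ⟧ * ⟦ dot a y ⟧) ≡ 2 ^ v + 2 ^ v * ⟦ does (x ≟ᵛ y) ⟧
∑-dot-dot {v} x y nx ny with x ≟ᵛ y
... | yes refl = begin
  4 * C                        ≡⟨ +-identityʳ (4 * C) ⟨
  4 * C + 2 * (0 * 2 ^ v)      ≡⟨ cong (λ n → 4 * C + 2 * n) (∑-const v 0) ⟨
  4 * C + 2 * ∑ {v} (λ _ → 0)
    ≡⟨ cong (λ n → 4 * C + 2 * n) (∑-cong (λ a → cong ⟦_⟧ (trans (dot-⊕ʳ a x x) (xor-same (dot a x))))) ⟨
  4 * C + 2 * ∑ (λ a → ⟦ dot a (x ⊕ x) ⟧) ≡⟨ ∑-dot-dot+∑-dot-⊕ x x nx nx ⟩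
  2 ^ v + 2 ^ v                ≡⟨ cong (2 ^ v +_) (*-identityʳ (2 ^ v)) ⟨
  2 ^ v + 2 ^ v * 1            ∎
  where open ≡-Reasoning
        C = ∑ (λ a → ⟦ dot a x ⟧ * ⟦ dot a x ⟧)
... | no x≢y = +-cancelʳ-≡ (2 ^ v) _ _ (begin
  4 * C + 2 ^ v                ≡⟨ cong (4 * C +_) (∑-dot (x ⊕ y) (≢⇒⊕-nonZero x y x≢y)) ⟨
  4 * C + 2 * ∑ (λ a → ⟦ dot a (x ⊕ y) ⟧) ≡⟨ ∑-dot-dot+∑-dot-⊕ x y nx ny ⟩
  2 ^ v + 2 ^ v                ≡⟨ cong (_+ 2 ^ v) (+-identityʳ (2 ^ v)) ⟨
  2 ^ v + 0 + 2 ^ v            ≡⟨ cong (λ n → 2 ^ v + n + 2 ^ v) (*-zeroʳ (2 ^ v)) ⟨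
  2 ^ v + 2 ^ v * 0 + 2 ^ v    ∎)
  where open ≡-Reasoning
        C = ∑ (λ a → ⟦ dot a x ⟧ * ⟦ dot a y ⟧)

-- This is #g − g(a⊥), the quantity #M − M(H) of the paper.
weight : ∀ {v} → (Vec Bool v → ℕ) → Vec Bool v → ℕ
weight g a = ∑ (λ x → ⟦ dot a x ⟧ * g x)

weight-zero : ∀ {v} (g : Vec Bool v → ℕ) a → isZeroVec a ≡ true → weight g a ≡ 0
weight-zero {v} g a z = trans (∑-cong (λ x → cong (λ d → ⟦ d ⟧ * g x) (dot-zeroˡ a x z))) (∑-const v 0)

restrict : ∀ {v} → Vec Bool v → (Vec Bool v → ℕ) → Vec Bool v → ℕ
restrict a g x = ⟦ not (dot a x) ⟧ * g x

∑-restrict+weight : ∀ {v} (a : Vec Bool v) g → ∑ (restrict a g) + weight g a ≡ ∑ g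
∑-restrict+weight a g = trans (sym (∑-+ (restrict a g) (λ x → ⟦ dot a x ⟧ * g x)))
                              (∑-cong (λ x → ⟦not⟧+⟦⟧ (dot a x) (g x)))

2*weight-restrict : ∀ {v} (a b : Vec Bool v) g →
  2 * weight (restrict a g) b + weight g a ≡ weight g b + weight g (a ⊕ b)
2*weight-restrict a b g = begin
  2 * weight (restrict a g) b + weight g a
    ≡⟨ cong (_+ weight g a) (∑-*ˡ 2 (λ x → ⟦ dot b x ⟧ * restrict a g x)) ⟨
  ∑ (λ x → 2 * (⟦ dot b x ⟧ * restrict a g x)) + weight g a
    ≡⟨ ∑-+ (λ x → 2 * (⟦ dot b x ⟧ * restrict a g x)) (λ x → ⟦ dot a x ⟧ * g x) ⟨
  ∑ (λ x → 2 * (⟦ dot b x ⟧ * restrict a g x) + ⟦ dot a x ⟧ * g x)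
    ≡⟨ ∑-cong (λ x → trans (2⟦⟧⟦not⟧+⟦⟧ (dot a x) (dot b x) (g x))
                           (cong (λ d → ⟦ dot b x ⟧ * g x + ⟦ d ⟧ * g x) (sym (dot-⊕ˡ a b x)))) ⟩
  ∑ (λ x → ⟦ dot b x ⟧ * g x + ⟦ dot (a ⊕ b) x ⟧ * g x)
    ≡⟨ ∑-+ (λ x → ⟦ dot b x ⟧ * g x) (λ x → ⟦ dot (a ⊕ b) x ⟧ * g x) ⟩
  weight g b + weight g (a ⊕ b)            ∎
  where open ≡-Reasoning

∑-*-weight : ∀ {v} (c g : Vec Bool v → ℕ) →
  ∑ (λ b → c b * weight g b) ≡ ∑ (λ x → ∑ (λ b → c b * ⟦ dot b x ⟧) * g x)
∑-*-weight c g = begin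
  ∑ (λ b → c b * ∑ (λ x → ⟦ dot b x ⟧ * g x))
    ≡⟨ ∑-cong (λ b → ∑-*ˡ (c b) (λ x → ⟦ dot b x ⟧ * g x)) ⟨
  ∑ (λ b → ∑ (λ x → c b * (⟦ dot b x ⟧ * g x)))          ≡⟨ ∑-swap (λ b x → c b * (⟦ dot b x ⟧ * g x)) ⟩
  ∑ (λ x → ∑ (λ b → c b * (⟦ dot b x ⟧ * g x)))
    ≡⟨ ∑-cong (λ x → ∑-cong (λ b → *-assoc (c b) ⟦ dot b x ⟧ (g x))) ⟨
  ∑ (λ x → ∑ (λ b → c b * ⟦ dot b x ⟧ * g x))
    ≡⟨ ∑-cong (λ x → ∑-*ʳ (g x) (λ b → c b * ⟦ dot b x ⟧)) ⟩
  ∑ (λ x → ∑ (λ b → c b * ⟦ dot b x ⟧) * g x)            ∎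
  where open ≡-Reasoning

module Moments {v} (g : Vec Bool v → ℕ) (g-zero : ∀ x → isZeroVec x ≡ true → g x ≡ 0) where

  ∑-*-on-support : ∀ {c c′ : Vec Bool v → ℕ} → (∀ x → NonZeroVec x → c x ≡ c′ x) →
    ∑ (λ x → c x * g x) ≡ ∑ (λ x → c′ x * g x)
  ∑-*-on-support {c} {c′} e = ∑-cong pointwise
    where
    pointwise : ∀ x → c x * g x ≡ c′ x * g x
    pointwise x with isZeroVec x in z
    ... | true rewrite g-zero x z = trans (*-zeroʳ (c x)) (sym (*-zeroʳ (c′ x)))
    ... | false = cong (_* g x) (e x z)

  ∑-weight : 2 * ∑ (weight g) ≡ 2 ^ v * ∑ g
  ∑-weight = begin
    2 * ∑ (weight g)                ≡⟨ cong (2 *_) (∑-cong (λ b → *-identityˡ (weight g b))) ⟨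
    2 * ∑ (λ b → 1 * weight g b)    ≡⟨ cong (2 *_) (∑-*-weight (λ _ → 1) g) ⟩
    2 * ∑ (λ x → C x * g x)         ≡⟨ ∑-*ˡ 2 (λ x → C x * g x) ⟨
    ∑ (λ x → 2 * (C x * g x))       ≡⟨ ∑-cong (λ x → *-assoc 2 (C x) (g x)) ⟨
    ∑ (λ x → 2 * C x * g x)
      ≡⟨ ∑-*-on-support (λ x nz → trans (cong (2 *_) (∑-cong (λ b → *-identityˡ ⟦ dot b x ⟧))) (∑-dot x nz)) ⟩
    ∑ (λ x → 2 ^ v * g x)           ≡⟨ ∑-*ˡ (2 ^ v) g ⟩
    2 ^ v * ∑ g                     ∎
    where open ≡-Reasoning
          C : Vec Bool v → ℕ
          C x = ∑ (λ b → 1 * ⟦ dot b x ⟧)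

  ∑-weight-outside : ∀ P → NonZeroVec P → 4 * ∑ (λ b → ⟦ dot b P ⟧ * weight g b) ≡ 2 ^ v * (∑ g + g P)
  ∑-weight-outside P nP = begin
    4 * ∑ (λ b → ⟦ dot b P ⟧ * weight g b)                  ≡⟨ cong (4 *_) (∑-*-weight (λ b → ⟦ dot b P ⟧) g) ⟩
    4 * ∑ (λ x → C x * g x)                                 ≡⟨ ∑-*ˡ 4 (λ x → C x * g x) ⟨
    ∑ (λ x → 4 * (C x * g x))                               ≡⟨ ∑-cong (λ x → *-assoc 4 (C x) (g x)) ⟨
    ∑ (λ x → 4 * C x * g x)                                 ≡⟨ ∑-*-on-support (λ x → ∑-dot-dot P x nP) ⟩
    ∑ (λ x → (2 ^ v + 2 ^ v * ⟦ does (P ≟ᵛ x) ⟧) * g x)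
      ≡⟨ ∑-cong (λ x → trans (*-distribʳ-+ (g x) (2 ^ v) (2 ^ v * ⟦ does (P ≟ᵛ x) ⟧))
                                   (cong (2 ^ v * g x +_) (*-assoc (2 ^ v) ⟦ does (P ≟ᵛ x) ⟧ (g x)))) ⟩
    ∑ (λ x → 2 ^ v * g x + 2 ^ v * (⟦ does (P ≟ᵛ x) ⟧ * g x))
      ≡⟨ ∑-+ (λ x → 2 ^ v * g x) (λ x → 2 ^ v * (⟦ does (P ≟ᵛ x) ⟧ * g x)) ⟩
    ∑ (λ x → 2 ^ v * g x) + ∑ (λ x → 2 ^ v * (⟦ does (P ≟ᵛ x) ⟧ * g x))
      ≡⟨ cong₂ _+_ (∑-*ˡ (2 ^ v) g)
                   (trans (∑-*ˡ (2 ^ v) (λ x → ⟦ does (P ≟ᵛ x) ⟧ * g x)) (cong (2 ^ v *_) (∑-δ P g))) ⟩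
    2 ^ v * ∑ g + 2 ^ v * g P                               ≡⟨ *-distribˡ-+ (2 ^ v) (∑ g) (g P) ⟨
    2 ^ v * (∑ g + g P)                                     ∎
    where open ≡-Reasoning
          C : Vec Bool v → ℕ
          C x = ∑ (λ b → ⟦ dot b P ⟧ * ⟦ dot b x ⟧)

  ∑-weight-inside : ∀ P → NonZeroVec P → 4 * ∑ (λ b → ⟦ not (dot b P) ⟧ * weight g b) + 2 ^ v * g P ≡ 2 ^ v * ∑ g
  ∑-weight-inside P nP = +-cancelʳ-≡ N∑ (4 * I + 2 ^ v * g P) N∑ (begin
    4 * I + 2 ^ v * g P + N∑       ≡⟨ +-assoc (4 * I) (2 ^ v * g P) N∑ ⟩
    4 * I + (2 ^ v * g P + N∑)     ≡⟨ cong (4 * I +_) (+-comm (2 ^ v * g P) N∑) ⟩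
    4 * I + (N∑ + 2 ^ v * g P)     ≡⟨ cong (4 * I +_) (trans (∑-weight-outside P nP) (*-distribˡ-+ (2 ^ v) (∑ g) (g P))) ⟨
    4 * I + 4 * O                  ≡⟨ *-distribˡ-+ 4 I O ⟨
    4 * (I + O)                    ≡⟨ cong (4 *_) I+O ⟩
    4 * ∑ (weight g)               ≡⟨ *-assoc 2 2 (∑ (weight g)) ⟩
    2 * (2 * ∑ (weight g))         ≡⟨ cong (2 *_) ∑-weight ⟩
    2 * N∑                         ≡⟨ cong (N∑ +_) (+-identityʳ N∑) ⟩
    N∑ + N∑                        ∎)
    where open ≡-Reasoning
          N∑ = 2 ^ v * ∑ g
          I = ∑ (λ b → ⟦ not (dot b P) ⟧ * weight g b)
          O = ∑ (λ b → ⟦ dot b P ⟧ * weight g b)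
          I+O : I + O ≡ ∑ (weight g)
          I+O = trans (sym (∑-+ (λ b → ⟦ not (dot b P) ⟧ * weight g b) (λ b → ⟦ dot b P ⟧ * weight g b)))
                      (∑-cong (λ b → ⟦not⟧+⟦⟧ (dot b P) (weight g b)))

  ∑-weight² : 4 * ∑ (λ a → weight g a * weight g a) ≡ 2 ^ v * (∑ g * ∑ g + ∑ (λ x → g x * g x))
  ∑-weight² = begin
    4 * ∑ (λ a → weight g a * weight g a)                   ≡⟨ cong (4 *_) (∑-*-weight (weight g) g) ⟩
    4 * ∑ (λ x → C x * g x)                                 ≡⟨ ∑-*ˡ 4 (λ x → C x * g x) ⟨
    ∑ (λ x → 4 * (C x * g x))                               ≡⟨ ∑-cong (λ x → *-assoc 4 (C x) (g x)) ⟨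
    ∑ (λ x → 4 * C x * g x)
      ≡⟨ ∑-*-on-support (λ x nz → trans (cong (4 *_) (∑-cong (λ b → *-comm (weight g b) ⟦ dot b x ⟧)))
                                         (∑-weight-outside x nz)) ⟩
    ∑ (λ x → 2 ^ v * (∑ g + g x) * g x)
      ≡⟨ ∑-cong (λ x → trans (*-assoc (2 ^ v) (∑ g + g x) (g x)) (cong (2 ^ v *_) (*-distribʳ-+ (g x) (∑ g) (g x)))) ⟩
    ∑ (λ x → 2 ^ v * (∑ g * g x + g x * g x))               ≡⟨ ∑-*ˡ (2 ^ v) (λ x → ∑ g * g x + g x * g x) ⟩
    2 ^ v * ∑ (λ x → ∑ g * g x + g x * g x)
      ≡⟨ cong (2 ^ v *_) (trans (∑-+ (λ x → ∑ g * g x) (λ x → g x * g x))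
                                (cong (_+ ∑ (λ x → g x * g x)) (∑-*ˡ (∑ g) g))) ⟩
    2 ^ v * (∑ g * ∑ g + ∑ (λ x → g x * g x))               ∎
    where open ≡-Reasoning
          C : Vec Bool v → ℕ
          C x = ∑ (λ b → weight g b * ⟦ dot b x ⟧)

data AdmissibleWeight : ℕ → Set where
  0w : AdmissibleWeight 0
  8w : AdmissibleWeight 8
  16w : AdmissibleWeight 16

residue⇒admissible : ∀ {h w} → h + w ≡ 23 → h % 8 ≡ 7 → AdmissibleWeight w
residue⇒admissible {h} {w} h+w≡23 h%8≡7 = from-quotient (h / 8) (begin
  7 + h / 8 * 8 + w       ≡⟨ cong (λ r → r + h / 8 * 8 + w) h%8≡7 ⟨
  h % 8 + h / 8 * 8 + w   ≡⟨ cong (_+ w) (m≡m%n+[m/n]*n h 8) ⟨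
  h + w                   ≡⟨ h+w≡23 ⟩
  23                      ∎)
  where
  open ≡-Reasoning
  from-quotient : ∀ q {w} → 7 + q * 8 + w ≡ 23 → AdmissibleWeight w
  from-quotient 0 refl = 16w
  from-quotient 1 refl = 8w
  from-quotient 2 refl = 0w
  from-quotient (suc (suc (suc q))) ()

-- (w − 8)(w − 16) ≥ 0, with the negative terms moved across.
24w≤w²+128 : ∀ {w} → AdmissibleWeight w → 24 * w ≤ w * w + 128
24w≤w²+128 0w = z≤n
24w≤w²+128 8w = ≤-refl
24w≤w²+128 16w = ≤-refl

admissible-sum⇒≡4 : ∀ {p q} u → AdmissibleWeight p → AdmissibleWeight q →
  16 + 2 * u ≡ p + q → 2 ≤ u → u ≤ 7 → u ≡ 4
admissible-sum⇒≡4 u 0w 0w ()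
admissible-sum⇒≡4 u 0w 8w ()
admissible-sum⇒≡4 u 8w 0w ()
admissible-sum⇒≡4 (suc (suc u)) 0w 16w () (s≤s (s≤s _))
admissible-sum⇒≡4 (suc (suc u)) 8w 8w () (s≤s (s≤s _))
admissible-sum⇒≡4 (suc (suc u)) 16w 0w () (s≤s (s≤s _))
admissible-sum⇒≡4 u 8w 16w e _ _ = *-cancelˡ-≡ u 4 2 (+-cancelˡ-≡ 16 (2 * u) 8 e)
admissible-sum⇒≡4 u 16w 8w e _ _ = *-cancelˡ-≡ u 4 2 (+-cancelˡ-≡ 16 (2 * u) 8 e)
admissible-sum⇒≡4 u 16w 16w e _ u≤7 with *-cancelˡ-≡ u 8 2 (+-cancelˡ-≡ 16 (2 * u) 16 e)
... | refl = ⊥-elim (1+n≰n u≤7)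

moments-inconsistent : ∀ N S₁ S₂ Q → 0 < N → 2 * S₁ ≡ N * 23 → 4 * S₂ ≡ N * (23 * 23 + Q) →
  24 * S₁ ≤ S₂ + 128 * N → Q ≤ 23 → ⊥
moments-inconsistent N S₁ S₂ Q 0<N e₁ e₂ gap Q≤23 = <⇒≢ 0<N (sym (*-cancelˡ-≡ N 0 40 (n≤0⇒n≡0 40N≤0)))
  where
  open ≤-Reasoning
  r₁ : ∀ N → 1064 * N + 40 * N ≡ 48 * (N * 23)
  r₁ = solve-∀
  r₂ : ∀ S → 48 * (2 * S) ≡ 4 * (24 * S)
  r₂ = solve-∀
  r₃ : ∀ S N → 4 * (S + 128 * N) ≡ 4 * S + 512 * N
  r₃ = solve-∀
  r₄ : ∀ N → N * (529 + 23) + 512 * N ≡ 1064 * N + 0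
  r₄ = solve-∀
  40N≤0 : 40 * N ≤ 0
  40N≤0 = +-cancelˡ-≤ (1064 * N) (40 * N) 0 (begin
    1064 * N + 40 * N              ≡⟨ r₁ N ⟩
    48 * (N * 23)                  ≡⟨ cong (48 *_) e₁ ⟨
    48 * (2 * S₁)                  ≡⟨ r₂ S₁ ⟩
    4 * (24 * S₁)                  ≤⟨ *-monoʳ-≤ 4 gap ⟩
    4 * (S₂ + 128 * N)             ≡⟨ r₃ S₂ N ⟩
    4 * S₂ + 512 * N               ≡⟨ cong (_+ 512 * N) e₂ ⟩
    N * (529 + Q) + 512 * N        ≤⟨ +-monoˡ-≤ (512 * N) (*-monoʳ-≤ N (+-monoʳ-≤ 529 Q≤23)) ⟩
    N * (529 + 23) + 512 * N       ≡⟨ r₄ N ⟩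
    1064 * N + 0                   ∎)

inside-sum-inconsistent : ∀ N S k → 4 * S + N * k ≡ N * 23 → k ≤ 7 → 4 * S + 32 ≤ 16 * N → ⊥
inside-sum-inconsistent N S k e k≤7 bound = 32≰0 (+-cancelˡ-≤ (16 * N) 32 0 (begin
  16 * N + 32                    ≤⟨ +-monoˡ-≤ 32 16N≤4S ⟩
  4 * S + 32                     ≤⟨ bound ⟩
  16 * N                         ≡⟨ +-identityʳ (16 * N) ⟨
  16 * N + 0                     ∎))
  where
  open ≤-Reasoning
  32≰0 : ¬ 32 ≤ 0
  32≰0 ()
  r : ∀ N → 16 * N + N * 7 ≡ N * 23
  r = solve-∀
  16N≤4S : 16 * N ≤ 4 * S
  16N≤4S = +-cancelʳ-≤ (N * 7) (16 * N) (4 * S) (begin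
    16 * N + N * 7               ≡⟨ r N ⟩
    N * 23                       ≡⟨ e ⟨
    4 * S + N * k                ≤⟨ +-monoʳ-≤ (4 * S) (*-monoʳ-≤ N k≤7) ⟩
    4 * S + N * 7                ∎)

module TwentyThreePoints {v} (m : Vec Bool v → ℕ) (m-zero : ∀ x → isZeroVec x ≡ true → m x ≡ 0)
  (∑m≡23 : ∑ m ≡ 23) (admissible : ∀ a → AdmissibleWeight (weight m a)) where

  open Moments m m-zero

  positive⇒nonZero : ∀ x → 0 < m x → NonZeroVec x
  positive⇒nonZero x 0<mx with isZeroVec x in z
  ... | true = ⊥-elim (<⇒≢ 0<mx (sym (m-zero x z)))
  ... | false = refl

  ¬all-multiplicities≤1 : (∀ x → m x ≤ 1) → ⊥
  ¬all-multiplicities≤1 m≤1 = moments-inconsistent (2 ^ v) (∑ (weight m)) (∑ (λ a → weight m a * weight m a))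
    (∑ (λ x → m x * m x)) (m^n>0 2 v)
    (trans ∑-weight (cong (2 ^ v *_) ∑m≡23))
    (trans ∑-weight² (cong (λ s → 2 ^ v * (s * s + ∑ (λ x → m x * m x))) ∑m≡23))
    gap ∑m²≤23
    where
    open ≤-Reasoning
    gap : 24 * ∑ (weight m) ≤ ∑ (λ a → weight m a * weight m a) + 128 * 2 ^ v
    gap = begin
      24 * ∑ (weight m)                                       ≡⟨ ∑-*ˡ 24 (weight m) ⟨
      ∑ (λ a → 24 * weight m a)                               ≤⟨ ∑-mono (λ a → 24w≤w²+128 (admissible a)) ⟩
      ∑ (λ a → weight m a * weight m a + 128)                 ≡⟨ ∑-+ (λ a → weight m a * weight m a) (λ _ → 128) ⟩
      ∑ (λ a → weight m a * weight m a) + ∑ {v} (λ _ → 128)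
        ≡⟨ cong (∑ (λ a → weight m a * weight m a) +_) (∑-const v 128) ⟩
      ∑ (λ a → weight m a * weight m a) + 128 * 2 ^ v         ∎
    ∑m²≤23 : ∑ (λ x → m x * m x) ≤ 23
    ∑m²≤23 = begin
      ∑ (λ x → m x * m x)     ≤⟨ ∑-mono (λ x → ≤-trans (*-monoʳ-≤ (m x) (m≤1 x)) (≤-reflexive (*-identityʳ (m x)))) ⟩
      ∑ m                     ≡⟨ ∑m≡23 ⟩
      23                      ∎

  ¬weights≤8-through : ∀ P → 2 ≤ m P → m P ≤ 7 → (∀ a → dot a P ≡ false → weight m a ≤ 8) → ⊥
  ¬weights≤8-through P 2≤mP mP≤7 light =
    inside-sum-inconsistent (2 ^ v) S (m P) (trans (∑-weight-inside P nP) (cong (2 ^ v *_) ∑m≡23)) mP≤7 bound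
    where
    open ≤-Reasoning
    nP : NonZeroVec P
    nP = positive⇒nonZero P (≤-trans (s≤s z≤n) 2≤mP)

    S : ℕ
    S = ∑ (λ a → ⟦ not (dot a P) ⟧ * weight m a)

    -- The zero vector lies in every P⊥ and has weight 0: this is the slack of 8 in the bound.
    o : Vec Bool v
    o = replicate v false

    pointwise : ∀ a → ⟦ not (dot a P) ⟧ * weight m a + ⟦ does (o ≟ᵛ a) ⟧ * 8 ≤ ⟦ not (dot a P) ⟧ * 8
    pointwise a with o ≟ᵛ a
    ... | yes refl rewrite dot-zeroˡ o P (replicate-isZero v) | weight-zero m o (replicate-isZero v) = ≤-refl
    ... | no _ with dot a P in aP
    ...   | true = z≤n
    ...   | false = ≤-trans (≤-reflexive (trans (+-identityʳ _) (+-identityʳ (weight m a)))) (light a aP)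

    bound : 4 * S + 32 ≤ 16 * 2 ^ v
    bound = begin
      4 * S + 32                                                    ≡⟨ *-distribˡ-+ 4 S 8 ⟨
      4 * (S + 8)                                                   ≡⟨ cong (λ n → 4 * (S + n)) (∑-δ o (λ _ → 8)) ⟨
      4 * (S + ∑ (λ a → ⟦ does (o ≟ᵛ a) ⟧ * 8))
        ≡⟨ cong (4 *_) (∑-+ (λ a → ⟦ not (dot a P) ⟧ * weight m a) (λ a → ⟦ does (o ≟ᵛ a) ⟧ * 8)) ⟨
      4 * ∑ (λ a → ⟦ not (dot a P) ⟧ * weight m a + ⟦ does (o ≟ᵛ a) ⟧ * 8)
        ≤⟨ *-monoʳ-≤ 4 (∑-mono pointwise) ⟩
      4 * ∑ (λ a → ⟦ not (dot a P) ⟧ * 8)                           ≡⟨ cong (4 *_) (∑-*ʳ 8 (λ a → ⟦ not (dot a P) ⟧)) ⟩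
      4 * (∑ (λ a → ⟦ not (dot a P) ⟧) * 8)                         ≡⟨ r (∑ (λ a → ⟦ not (dot a P) ⟧)) ⟩
      16 * (2 * ∑ (λ a → ⟦ not (dot a P) ⟧))                        ≡⟨ cong (16 *_) (∑-not-dot P nP) ⟩
      16 * 2 ^ v                                                    ∎
      where
      r : ∀ X → 4 * (X * 8) ≡ 16 * (2 * X)
      r = solve-∀

  ¬weight16-through : ∀ P a → 2 ≤ m P → dot a P ≡ false → weight m a ≡ 16 → ⊥
  ¬weight16-through P a 2≤mP aP≡false wa≡16 =
    8≢7+k 2≤mP (*-cancelˡ-≡ 8 (7 + m P) (2 ^ v) {{m^n≢0 2 v}} (trans (sym by-values) by-moments))
    where
    open ≡-Reasoning
    nP : NonZeroVec P
    nP = positive⇒nonZero P (≤-trans (s≤s z≤n) 2≤mP)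

    g : Vec Bool v → ℕ
    g = restrict a m

    g-zero : ∀ x → isZeroVec x ≡ true → g x ≡ 0
    g-zero x z = trans (cong (⟦ not (dot a x) ⟧ *_) (m-zero x z)) (*-zeroʳ ⟦ not (dot a x) ⟧)

    gP≡mP : g P ≡ m P
    gP≡mP = trans (cong (λ d → ⟦ not d ⟧ * m P) aP≡false) (*-identityˡ (m P))

    ∑g≡7 : ∑ g ≡ 7
    ∑g≡7 = +-cancelʳ-≡ 16 (∑ g) 7 (trans (cong (∑ g +_) (sym wa≡16)) (trans (∑-restrict+weight a m) ∑m≡23))

    u : Vec Bool v → ℕ
    u = weight g

    u≤7 : ∀ b → u b ≤ 7
    u≤7 b = ≤-trans (∑-mono (λ x → ⟦⟧*-≤ (dot b x) (g x))) (≤-reflexive ∑g≡7)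

    mP≤u : ∀ b → dot b P ≡ true → m P ≤ u b
    mP≤u b bP≡true = ≤-trans (≤-reflexive (sym (trans (cong (λ d → ⟦ d ⟧ * g P) bP≡true) (trans (*-identityˡ (g P)) gP≡mP))))
                             (term≤∑ P (λ x → ⟦ dot b x ⟧ * g x))

    u≡4 : ∀ b → dot b P ≡ true → u b ≡ 4
    u≡4 b bP≡true = admissible-sum⇒≡4 (u b) (admissible b) (admissible (a ⊕ b))
      (trans (+-comm 16 (2 * u b)) (trans (cong (2 * u b +_) (sym wa≡16)) (2*weight-restrict a b m)))
      (≤-trans 2≤mP (mP≤u b bP≡true)) (u≤7 b)

    by-values : 4 * ∑ (λ b → ⟦ dot b P ⟧ * u b) ≡ 2 ^ v * 8
    by-values = begin
      4 * ∑ (λ b → ⟦ dot b P ⟧ * u b)          ≡⟨ cong (4 *_) (∑-cong u≡4-outside) ⟩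
      4 * ∑ (λ b → ⟦ dot b P ⟧ * 4)            ≡⟨ cong (4 *_) (∑-*ʳ 4 (λ b → ⟦ dot b P ⟧)) ⟩
      4 * (∑ (λ b → ⟦ dot b P ⟧) * 4)          ≡⟨ r (∑ (λ b → ⟦ dot b P ⟧)) ⟩
      2 * ∑ (λ b → ⟦ dot b P ⟧) * 8            ≡⟨ cong (_* 8) (∑-dot P nP) ⟩
      2 ^ v * 8                                ∎
      where
      r : ∀ X → 4 * (X * 4) ≡ 2 * X * 8
      r = solve-∀
      u≡4-outside : ∀ b → ⟦ dot b P ⟧ * u b ≡ ⟦ dot b P ⟧ * 4
      u≡4-outside b with dot b P in bP
      ... | true = cong (1 *_) (u≡4 b bP)
      ... | false = refl

    by-moments : 4 * ∑ (λ b → ⟦ dot b P ⟧ * u b) ≡ 2 ^ v * (7 + m P)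
    by-moments = trans (Moments.∑-weight-outside g g-zero P nP) (cong₂ (λ s t → 2 ^ v * (s + t)) ∑g≡7 gP≡mP)

    8≢7+k : ∀ {k} → 2 ≤ k → 8 ≢ 7 + k
    8≢7+k (s≤s (s≤s _)) ()

  multiplicity≤1 : (∀ x → m x ≤ 7) → ∀ P → m P ≤ 1
  multiplicity≤1 m≤7 P with m P ≤? 1
  ... | yes mP≤1 = mP≤1
  ... | no mP≰1 = ⊥-elim (¬weights≤8-through P 2≤mP (m≤7 P) light)
    where
    2≤mP : 2 ≤ m P
    2≤mP = ≰⇒> mP≰1
    light : ∀ a → dot a P ≡ false → weight m a ≤ 8
    light a aP with weight m a in wa | admissible a
    ... | _ | 0w = z≤n
    ... | _ | 8w = ≤-refl
    ... | _ | 16w = ⊥-elim (¬weight16-through P a 2≤mP aP wa)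

  ¬multiplicities≤7 : (∀ x → m x ≤ 7) → ⊥
  ¬multiplicities≤7 m≤7 = ¬all-multiplicities≤1 (multiplicity≤1 m≤7)

allVecs-complete : ∀ {v} (x : Vec Bool v) → x ∈ allVecs v
allVecs-complete [] = here refl
allVecs-complete {suc v} (false ∷ x) = ∈-++⁺ˡ (∈-map⁺ (false ∷_) (allVecs-complete x))
allVecs-complete {suc v} (true ∷ x) = ∈-++⁺ʳ (map (false ∷_) (allVecs v)) (∈-map⁺ (true ∷_) (allVecs-complete x))

module _ {v} (M : Multiset v) where

  -- Defs ignores the multiplicity of the zero vector; setting it to 0 lets sums range over F₂^v.
  extend : Vec Bool v → ℕ
  extend x = ⟦ not (isZeroVec x) ⟧ * M x

  extend-zero : ∀ x → isZeroVec x ≡ true → extend x ≡ 0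
  extend-zero x z rewrite z = refl

  card≡∑extend : card M ≡ ∑ extend
  card≡∑extend = sum-map-filter (allVecs v) isZeroVec M

  hypMass≡∑restrict : ∀ a → hypMass M a ≡ ∑ (restrict a extend)
  hypMass≡∑restrict a = begin
    hypMass M a
      ≡⟨ trans (sum-map-filter (nonzeroVecs v) (dot a) M) (sum-map-filter (allVecs v) isZeroVec (restrict a M)) ⟩
    ∑ (λ x → ⟦ not (isZeroVec x) ⟧ * (⟦ not (dot a x) ⟧ * M x))
      ≡⟨ ∑-cong (λ x → *-left-comm ⟦ not (isZeroVec x) ⟧ ⟦ not (dot a x) ⟧ (M x)) ⟩
    ∑ (restrict a extend) ∎
    where open ≡-Reasoning

  weight-admissible : Divisible 8 M → card M ≡ 23 → ∀ a → AdmissibleWeight (weight extend a)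
  weight-admissible div card≡23 a with isZeroVec a in z
  ... | true rewrite weight-zero extend a z = 0w
  ... | false = residue⇒admissible (trans (cong (_+ weight extend a) (hypMass≡∑restrict a))
                                          (trans (∑-restrict+weight a extend) (trans (sym card≡∑extend) card≡23)))
                                   (trans (div a z) (cong (_% 8) card≡23))

  extend≤γ₁ : ∀ x → extend x ≤ γ₁ M
  extend≤γ₁ x with isZeroVec x in z
  ... | true = z≤n
  ... | false = ≤-trans (≤-reflexive (*-identityˡ (M x)))
                        (foldr-⊔-upper (∈-filter⁺ (λ y → Data.Bool._≟_ (isZeroVec y) false) (allVecs-complete x) z))
    where
    foldr-⊔-upper : ∀ {y ys} → y ∈ ys → M y ≤ foldr (λ z r → M z ⊔ r) 0 ys
    foldr-⊔-upper {ys = y ∷ _} (here refl) = m≤m⊔n (M y) _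
    foldr-⊔-upper {ys = y ∷ _} (there y∈ys) = ≤-trans (foldr-⊔-upper y∈ys) (m≤n⊔m (M y) _)

lemma36 : (v : ℕ) (M : Multiset v) → Divisible 8 M → card M ≡ 23 → 8 ≤ γ₁ M
lemma36 v M div card≡23 with 8 ≤? γ₁ M
... | yes 8≤γ₁ = 8≤γ₁
... | no 8≰γ₁ = ⊥-elim (TwentyThreePoints.¬multiplicities≤7 (extend M) (extend-zero M)
                          (trans (sym (card≡∑extend M)) card≡23) (weight-admissible M div card≡23)
                          (λ x → ≤-trans (extend≤γ₁ M x) (≤-pred (≰⇒> 8≰γ₁))))
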